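{- Let $\mathcal{R}$ be a $d$-oik on a linearly ordered finite set $V$. Let $S=\mathcal{R}$ (each occurrence of a room being a state), $m=d$, and for a room $R=\{s_1,\dots,s_d\}$ with $s_1<\dots<s_d$ let $r(R)=(s_1,\dots,s_d)$. For every wall $W$, match the $2k$ rooms containing $W$ into $k$ pairs $(R,R')$, where, if the oik is oriented by a coherent orientation $\sigma$, the two rooms of each pair induce opposite orientations on $W$. Define $f(R,i)=R'$ if $r(R)=(s_1,\dots,s_d)$ and $R'$ is the room paired with $R$ for the wall $W=R\setminus\{s_i\}$. Then $(S,V,m,r,f)$ is a pivoting system, and if $\sigma$ is a coherent orientation (and the pairing is as described), this pivoting system is oriented with orientation $\sigma$.
   Context: For an integer $d\ge 2$, a $d$-dimensional Euler complex or $d$-oik on a finite node set $V$ is a multiset $\mathcal{R}$ of $d$-element subsets of $V$ (rooms) such that every $(d-1)$-element subset of $V$ is contained in an even number of rooms. A wall is a $(d-1)$-element subset of a room. With $V$ linearly ordered and each room represented as $r(R)=(s_1,\dots,s_d)$ in increasing order, an orientation assigns $\sigma(R)\in\{ -1,1\}$ to each room; the induced orientation on the wall $R\setminus\{s_i\}$ is $(-1)^i\sigma(R)$. The orientation is coherent (and the oik oriented) if for every wall $W$, half of the rooms containing $W$ induce orientation $1$ on $W$ and the other half induce $-1$. A pivoting system $(S,V,m,r,f)$: finite sets $S$ (states) and $V$ (nodes), $r:S\to V^m$, $f:S\times[m]\to S$, such that for each $s,i$, with $t=f(s,i)$, $r(s)=(s_1,\dots,s_m)$, $r(t)=(t_1,\dots,t_m)$,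 there is a permutation $\pi=\pi(s,i)$ of $[m]$ with $(t_{\pi(1)},\dots,t_{\pi(m)})=(s_1,\dots,s_{i-1},u,s_{i+1},\dots,s_m)$ for some $u\in V$ and $f(t,\pi(i))=s$; it is oriented with $\sigma:S\to\{ -1,1\}$ if $\sigma(t)=-\sigma(s)\cdot\operatorname{parity}(\pi)$ for all such $s,i,t,\pi$, where parity is $(-1)^{\#\text{inversions}}$. -}

module Defs where

open import Data.Nat using (ℕ; zero; suc; _∸_)
open import Data.Nat.Divisibility using (_∣_)
open import Data.Bool using (Bool; true; false; if_then_else_)
open import Data.Fin using (Fin; toℕ; _<_; _>_; _<?_; _≟_)
open import Data.Fin.Properties using (any?)
open import Data.Fin.Subset using (Subset; _⊆_; ∣_∣)
open import Data.Fin.Subset.Properties using (_⊆?_)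
open import Data.Fin.Permutation using (Permutation′; _⟨$⟩ʳ_)
open import Data.Vec using (tabulate)
open import Data.Vec.Properties using (≡-dec)
import Data.Bool.Properties as BoolP
open import Data.Vec.Functional using (updateAt)
open import Data.List using (List; length; filter; cartesianProduct)
open import Data.List.Base using (allFin)
open import Data.Product using (Σ; ∃; _×_; _,_; proj₁; proj₂)
open import Data.Sign using (Sign; opposite) renaming (_*_ to _*ˢ_)
import Data.Sign as Sgn
open import Relation.Nullary using (Dec; yes; no; does; ¬_)
open import Relation.Nullary.Decidable using (_×-dec_; ¬?)
open import Relation.Unary using (Decidable)
open import Relation.Binary.PropositionalEquality using (_≡_; _≢_)

countL : {A : Set} {P : A → Set} → Decidable P → List A → ℕ
countL P? xs = length (filter P? xs)

signPow : ℕ → Sign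
signPow zero    = Sgn.+
signPow (suc k) = opposite (signPow k)

inversions : {m : ℕ} → Permutation′ m → ℕ
inversions {m} π =
  countL (λ (p : Fin m × Fin m) →
            (proj₁ p <? proj₂ p) ×-dec (π ⟨$⟩ʳ proj₂ p <? π ⟨$⟩ʳ proj₁ p))
         (cartesianProduct (allFin m) (allFin m))

parity : {m : ℕ} → Permutation′ m → Sign
parity π = signPow (inversions π)

-- Pivoting systems (S, V, m, r, f); tuples r(s) are functions Fin m → V,
-- position i ∈ [m] is represented by i : Fin m (0-based).

module _ {S V : Set} (m : ℕ) (r : S → Fin m → V) (f : S → Fin m → S) where

  PivotPerm : S → Fin m → Permutation′ m → Set
  PivotPerm s i π =
    (∃ λ (u : V) → ∀ j → r (f s i) (π ⟨$⟩ʳ j) ≡ updateAt (r s) i (λ _ → u) j)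
    × f (f s i) (π ⟨$⟩ʳ i) ≡ s

  IsPivotingSystem : Set
  IsPivotingSystem = ∀ s i → ∃ λ (π : Permutation′ m) → PivotPerm s i π

  IsOrientedBy : (S → Sign) → Set
  IsOrientedBy σ = ∀ s i (π : Permutation′ m) → PivotPerm s i π →
                   σ (f s i) ≡ opposite (σ s *ˢ parity π)

-- d-oiks on V = Fin n (linear order of Fin n).  A multiset of N rooms is
-- an indexing  room : Fin N → (Fin d → Fin n)  where room R is the
-- increasing enumeration r(R) = (s_1,…,s_d) of the d-element room.

StrictlyIncreasing : {d n : ℕ} → (Fin d → Fin n) → Set
StrictlyIncreasing {d} s = ∀ (a b : Fin d) → a < b → s a < s b

module _ {d n N : ℕ} (room : Fin N → Fin d → Fin n) where

  roomSet : Fin N → Subset n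
  roomSet R = tabulate λ v → does (any? λ k → room R k ≟ v)

  wallOf : Fin N → Fin d → Subset n
  wallOf R i = tabulate λ v → does (any? λ k → ¬? (k ≟ i) ×-dec (room R k ≟ v))

  roomsContaining : Subset n → ℕ
  roomsContaining W = countL (λ R → W ⊆? roomSet R) (allFin N)

  IsOik : Set
  IsOik = ∀ (W : Subset n) → ∣ W ∣ ≡ d ∸ 1 → 2 ∣ roomsContaining W

  IsPairing : (Subset n → Fin N → Fin N) → Set
  IsPairing mate = ∀ (W : Subset n) → ∣ W ∣ ≡ d ∸ 1 → ∀ R → W ⊆ roomSet R →
    W ⊆ roomSet (mate W R) × mate W R ≢ R × mate W (mate W R) ≡ R

  pivotMap : (Subset n → Fin N → Fin N) → Fin N → Fin d → Fin N
  pivotMap mate R i = mate (wallOf R i) R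

  -- orientation induced on the wall R ∖ {s_i} : (-1)^i σ(R)  (i 1-based)
  induced : (Fin N → Sign) → Fin N → Fin d → Sign
  induced σ R i = signPow (suc (toℕ i)) *ˢ σ R

  -- number of rooms containing W inducing sign ε on W (each room R containing
  -- W is counted once, via the unique i with W = R ∖ {s_i})
  inducing : (Fin N → Sign) → Subset n → Sign → ℕ
  inducing σ W ε =
    countL (λ (p : Fin N × Fin d) →
              ≡-dec BoolP._≟_ (wallOf (proj₁ p) (proj₂ p)) W
              ×-dec Sgn._≟_ (induced σ (proj₁ p) (proj₂ p)) ε)
           (cartesianProduct (allFin N) (allFin d))

  IsCoherent : (Fin N → Sign) → Set
  IsCoherent σ = ∀ (W : Subset n) → ∣ W ∣ ≡ d ∸ 1 →
                 inducing σ W Sgn.+ ≡ inducing σ W Sgn.-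

  PairingOpposite : (Subset n → Fin N → Fin N) → (Fin N → Sign) → Set
  PairingOpposite mate σ = ∀ (W : Subset n) → ∣ W ∣ ≡ d ∸ 1 → ∀ R i j →
    wallOf R i ≡ W → wallOf (mate W R) j ≡ W →
    induced σ (mate W R) j ≡ opposite (induced σ R i)

module Submission where

-- For a room R and a position i, the room R' paired with R at the wall W = R ∖ {s_i}
-- contains W and one more node u ∉ W. Replacing s_i by u in r(R) gives an injective
-- tuple with entries in R', hence a rearrangement r(R') ∘ π of r(R'); the wall of R'
-- at position π(i) is W again, so f(R', π(i)) = R.
--
-- For the orientation, any such π is monotone away from i, so all its inversions
-- involve i and parity(π) = (-1)^(i + π(i)). Since R and R' induce opposite
-- orientations on W, (-1)^π(i) σ(R') = -(-1)^i σ(R), whence σ(R') = -σ(R) parity(π).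

open import Defs
open import Data.Nat using (ℕ; zero; suc; _+_; _*_; _∸_; _≤_; s≤s; s≤s⁻¹)
import Data.Nat.Properties as ℕ
open import Data.Bool using (true; false; if_then_else_)
open import Data.Fin using (Fin; zero; suc; toℕ; _<_; _<?_; _≟_; punchIn; punchOut)
import Data.Fin.Properties as Fin
open import Data.Fin.Properties using (any?)
open import Data.Fin.Subset using (Subset; _∈_; _∉_; _⊆_; ∣_∣)
open import Data.Fin.Subset.Properties using (_∈?_)
open import Data.Fin.Permutation
  using (Permutation′; _⟨$⟩ʳ_; _⟨$⟩ˡ_; permutation; inverseˡ; inverseʳ)
open import Data.Vec using (tabulate)
import Data.Vec.Properties as Vec
open import Data.Vec.Functional using (updateAt)
import Data.Vec.Functional.Properties as VecF
open import Data.List using (List; []; _∷_; _++_; map; length; filter; cartesianProduct; allFin)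
import Data.List as List
import Data.List.Properties as List
open import Data.Product using (∃; _×_; _,_; proj₁; proj₂)
open import Data.Sign using (Sign; opposite) renaming (_*_ to _*ˢ_)
import Data.Sign as Sign
import Data.Sign.Properties as Sign
open import Function using (_∘_; mk⇔)
open import Function.Definitions using (Injective)
open import Level using (0ℓ)
open import Relation.Binary using (tri<; tri≈; tri>)
open import Relation.Binary.PropositionalEquality
open import Relation.Nullary using (Dec; yes; no; does; ¬_; contradiction)
open import Relation.Nullary.Decidable using (_×-dec_; ¬?; does-⇔; dec-true; dec-false)
open import Relation.Unary using (Pred; Decidable)
open import Algebra.Properties.CommutativeMonoid.Sum ℕ.+-0-commutativeMonoid
  using (sum; sum-cong-≗; sum-remove; sum-replicate-zero; ∑-distrib-+; ∑-comm; ∑-permute)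

private
  variable
    A B : Set
    d m n : ℕ

𝟙 : Dec A → ℕ
𝟙 a? = if does a? then 1 else 0

𝟙-yes : (a? : Dec A) → A → 𝟙 a? ≡ 1
𝟙-yes a? a rewrite dec-true a? a = refl

𝟙-no : (a? : Dec A) → ¬ A → 𝟙 a? ≡ 0
𝟙-no a? ¬a rewrite dec-false a? ¬a = refl

𝟙-cong : (a? : Dec A) (b? : Dec B) → (A → B) → (B → A) → 𝟙 a? ≡ 𝟙 b?
𝟙-cong a? b? to from = cong (λ b → if b then 1 else 0) (does-⇔ (mk⇔ to from) a? b?)

𝟙-<-trichotomy : {x y : Fin n} → x ≢ y → 𝟙 (x <? y) + 𝟙 (y <? x) ≡ 1
𝟙-<-trichotomy {x = x} {y} x≢y with Fin.<-cmp x y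
... | tri< x<y _ y≮x rewrite 𝟙-yes (x <? y) x<y | 𝟙-no (y <? x) y≮x = refl
... | tri≈ _ x≡y _ = contradiction x≡y x≢y
... | tri> x≮y _ y<x rewrite 𝟙-no (x <? y) x≮y | 𝟙-yes (y <? x) y<x = refl

∑-zero : (f : Fin n → ℕ) → (∀ k → f k ≡ 0) → sum f ≡ 0
∑-zero {n} f vanish = trans (sum-cong-≗ vanish) (sum-replicate-zero n)

∑-supported : (c : Fin n) (f : Fin n → ℕ) → (∀ k → k ≢ c → f k ≡ 0) → sum f ≡ f c
∑-supported {suc n} c f vanish = begin
  sum f                     ≡⟨ sum-remove {i = c} f ⟩
  f c + sum (f ∘ punchIn c) ≡⟨ cong (f c +_) (∑-zero _ (λ k → vanish _ (Fin.punchInᵢ≢i c k))) ⟩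
  f c + 0                   ≡⟨ ℕ.+-identityʳ (f c) ⟩
  f c                       ∎
  where open ≡-Reasoning

∑-δ : (c : Fin n) (f : Fin n → ℕ) → sum (λ k → 𝟙 (k ≟ c) * f k) ≡ f c
∑-δ c f = begin
  sum (λ k → 𝟙 (k ≟ c) * f k)
    ≡⟨ ∑-supported c _ (λ k k≢c → cong (_* f k) (𝟙-no (k ≟ c) k≢c)) ⟩
  𝟙 (c ≟ c) * f c             ≡⟨ cong (_* f c) (𝟙-yes (c ≟ c) refl) ⟩
  1 * f c                     ≡⟨ ℕ.*-identityˡ (f c) ⟩
  f c                         ∎
  where open ≡-Reasoning

∑-𝟙-< : (c : Fin n) → sum (λ (k : Fin n) → 𝟙 (k <? c)) ≡ toℕ c
∑-𝟙-< {suc n} zero =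
  ∑-zero (λ (k : Fin (suc n)) → 𝟙 (k <? zero {n})) (λ k → 𝟙-no (k <? zero {n}) λ ())
∑-𝟙-< {suc n} (suc c) = cong suc (trans
  (sum-cong-≗ (λ (k : Fin n) → 𝟙-cong (suc k <? suc c) (k <? c) s≤s⁻¹ s≤s))
  (∑-𝟙-< c))

∑-𝟙-≢ : (c : Fin n) → sum (λ k → 𝟙 (¬? (k ≟ c))) ≡ n ∸ 1
∑-𝟙-≢ {suc n} c = begin
  sum (λ k → 𝟙 (¬? (k ≟ c)))
    ≡⟨ sum-remove {i = c} (λ k → 𝟙 (¬? (k ≟ c))) ⟩
  𝟙 (¬? (c ≟ c)) + sum (λ k → 𝟙 (¬? (punchIn c k ≟ c)))
    ≡⟨ cong₂ _+_ (𝟙-no (¬? (c ≟ c)) (λ c≢c → c≢c refl))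
                 (sum-cong-≗ (λ k → 𝟙-yes (¬? (_ ≟ c)) (Fin.punchInᵢ≢i c k))) ⟩
  sum {n} (λ _ → 1)
    ≡⟨ ∑-1 n ⟩
  n ∎
  where
  open ≡-Reasoning
  ∑-1 : ∀ n → sum {n} (λ _ → 1) ≡ n
  ∑-1 zero = refl
  ∑-1 (suc n) = cong suc (∑-1 n)

𝟙-any : {Q : Pred (Fin n) 0ℓ} (Q? : Decidable Q) → (∀ {a b} → Q a → Q b → a ≡ b) →
        𝟙 (any? Q?) ≡ sum (λ k → 𝟙 (Q? k))
𝟙-any Q? unique with any? Q?
... | yes (c , q) = sym (trans
  (∑-supported c _ (λ k k≢c → 𝟙-no (Q? k) (λ qk → k≢c (unique qk q))))
  (𝟙-yes (Q? c) q))
... | no none = sym (∑-zero _ (λ k → 𝟙-no (Q? k) (λ qk → none (k , qk))))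

countL-∷ : {P : Pred A 0ℓ} (P? : Decidable P) (x : A) (xs : List A) →
           countL P? (x ∷ xs) ≡ 𝟙 (P? x) + countL P? xs
countL-∷ P? x xs with does (P? x)
... | true  = refl
... | false = refl

countL-++ : {P : Pred A 0ℓ} (P? : Decidable P) (xs ys : List A) →
            countL P? (xs ++ ys) ≡ countL P? xs + countL P? ys
countL-++ P? xs ys =
  trans (cong length (List.filter-++ P? xs ys)) (List.length-++ (filter P? xs))

countL-map : {P : Pred B 0ℓ} (P? : Decidable P) (h : A → B) (xs : List A) →
             countL P? (map h xs) ≡ countL (P? ∘ h) xs
countL-map P? h []       = refl
countL-map P? h (x ∷ xs) = trans (countL-∷ P? (h x) (map h xs))
  (trans (cong (𝟙 (P? (h x)) +_) (countL-map P? h xs)) (sym (countL-∷ (P? ∘ h) x xs)))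

countL-tabulate : {P : Pred A 0ℓ} (P? : Decidable P) (g : Fin n → A) →
                  countL P? (List.tabulate g) ≡ sum (λ k → 𝟙 (P? (g k)))
countL-tabulate {n = zero}  P? g = refl
countL-tabulate {n = suc n} P? g = trans (countL-∷ P? (g zero) _)
  (cong (𝟙 (P? (g zero)) +_) (countL-tabulate P? (g ∘ suc)))

countL-cartesianProduct : {P : Pred (A × B) 0ℓ} (P? : Decidable P) (g : Fin n → A) (ys : List B) →
  countL P? (cartesianProduct (List.tabulate g) ys)
    ≡ sum (λ k → countL (λ y → P? (g k , y)) ys)
countL-cartesianProduct {n = zero}  P? g ys = refl
countL-cartesianProduct {n = suc n} P? g ys = begin
  countL P? (map (g zero ,_) ys ++ cartesianProduct (List.tabulate (g ∘ suc)) ys)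
    ≡⟨ countL-++ P? (map (g zero ,_) ys) _ ⟩
  countL P? (map (g zero ,_) ys) + countL P? (cartesianProduct (List.tabulate (g ∘ suc)) ys)
    ≡⟨ cong₂ _+_ (countL-map P? (g zero ,_) ys) (countL-cartesianProduct P? (g ∘ suc) ys) ⟩
  countL (λ y → P? (g zero , y)) ys + sum (λ k → countL (λ y → P? (g (suc k) , y)) ys) ∎
  where open ≡-Reasoning

countL-allFin² : {P : Pred (Fin n × Fin n) 0ℓ} (P? : Decidable P) →
  countL P? (cartesianProduct (allFin n) (allFin n)) ≡ sum (λ a → sum (λ b → 𝟙 (P? (a , b))))
countL-allFin² P? = trans (countL-cartesianProduct P? (λ a → a) _)
  (sum-cong-≗ (λ a → countL-tabulate (λ b → P? (a , b)) (λ b → b)))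

strictlyIncreasing⇒injective : {s : Fin m → Fin n} → StrictlyIncreasing s →
                               Injective _≡_ _≡_ s
strictlyIncreasing⇒injective mono {a} {b} sa≡sb with Fin.<-cmp a b
... | tri< a<b _ _ = contradiction sa≡sb (Fin.<⇒≢ (mono a b a<b))
... | tri≈ _ a≡b _ = a≡b
... | tri> _ _ b<a = contradiction (sym sa≡sb) (Fin.<⇒≢ (mono b a b<a))

strictlyIncreasing-reflects-< : {s : Fin m → Fin n} → StrictlyIncreasing s →
                                ∀ {a b} → s a < s b → a < b
strictlyIncreasing-reflects-< mono {a} {b} sa<sb with Fin.<-cmp a b
... | tri< a<b _ _ = a<b
... | tri≈ _ refl _ = contradiction sa<sb (Fin.<-irrefl refl)
... | tri> _ _ b<a = contradiction (mono b a b<a) (Fin.<-asym sa<sb)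

injective⇒surjective : {g : Fin m → Fin m} → Injective _≡_ _≡_ g → ∀ y → ∃ λ x → g x ≡ y
injective⇒surjective {suc m} {g} g-inj y with any? (λ x → g x ≟ y)
... | yes hit = hit
... | no miss = contradiction (Fin.injective⇒≤ h-inj) ℕ.1+n≰n
  where
  y≢g : ∀ x → y ≢ g x
  y≢g x y≡gx = miss (x , sym y≡gx)
  h : Fin (suc m) → Fin m
  h x = punchOut (y≢g x)
  h-inj : Injective _≡_ _≡_ h
  h-inj {a} {b} = g-inj ∘ Fin.punchOut-injective (y≢g a) (y≢g b)

injective⇒permutation : {g : Fin m → Fin m} → Injective _≡_ _≡_ g →
                        ∃ λ (π : Permutation′ m) → ∀ k → π ⟨$⟩ʳ k ≡ g k
injective⇒permutation {g = g} g-inj =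
  permutation g (proj₁ ∘ onto) (proj₂ ∘ onto) (λ x → g-inj (proj₂ (onto (g x)))) , λ _ → refl
  where
  onto : ∀ y → ∃ λ x → g x ≡ y
  onto = injective⇒surjective g-inj

realign : {X : Set} {t s' : Fin m → X} → Injective _≡_ _≡_ t →
          (∀ k → ∃ λ k' → s' k' ≡ t k) →
          ∃ λ (π : Permutation′ m) → ∀ k → s' (π ⟨$⟩ʳ k) ≡ t k
realign {t = t} {s'} t-inj occurs =
  proj₁ π-position , λ k → trans (cong s' (proj₂ π-position k)) (proj₂ (occurs k))
  where
  position-inj : Injective _≡_ _≡_ (proj₁ ∘ occurs)
  position-inj {a} {b} e =
    t-inj (trans (sym (proj₂ (occurs a))) (trans (cong s' e) (proj₂ (occurs b))))
  π-position = injective⇒permutation position-inj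

∈-tabulate⁺ : {Q : Pred (Fin n) 0ℓ} (Q? : Decidable Q) {v : Fin n} →
              Q v → v ∈ tabulate (λ w → does (Q? w))
∈-tabulate⁺ Q? {v} q =
  Vec.lookup⇒[]= v _ (trans (Vec.lookup∘tabulate _ v) (dec-true (Q? v) q))

∈-tabulate⁻ : {Q : Pred (Fin n) 0ℓ} (Q? : Decidable Q) {v : Fin n} →
              v ∈ tabulate (λ w → does (Q? w)) → Q v
∈-tabulate⁻ Q? {v} v∈
  with Q? v | trans (sym (Vec.lookup∘tabulate (λ w → does (Q? w)) v)) (Vec.[]=⇒lookup v∈)
... | yes q | _ = q
... | no _  | ()

∣tabulate∣ : {Q : Pred (Fin n) 0ℓ} (Q? : Decidable Q) →
             ∣ tabulate (λ w → does (Q? w)) ∣ ≡ sum (λ w → 𝟙 (Q? w))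
∣tabulate∣ {zero}  Q? = refl
∣tabulate∣ {suc n} Q? with does (Q? zero)
... | true  = cong suc (∣tabulate∣ (Q? ∘ suc))
... | false = ∣tabulate∣ (Q? ∘ suc)

image : {P : Pred (Fin m) 0ℓ} → Decidable P → (Fin m → Fin n) → Subset n
image P? s = tabulate λ v → does (any? λ k → P? k ×-dec (s k ≟ v))

∣image∣ : {P : Pred (Fin m) 0ℓ} (P? : Decidable P) {s : Fin m → Fin n} → Injective _≡_ _≡_ s →
          ∣ image P? s ∣ ≡ sum (λ k → 𝟙 (P? k))
∣image∣ {m} {n} {P} P? {s} s-inj = begin
  ∣ image P? s ∣                        ≡⟨ ∣tabulate∣ (λ v → any? λ k → hit? k v) ⟩
  sum (λ v → 𝟙 (any? λ k → hit? k v))   ≡⟨ sum-cong-≗ (λ v → 𝟙-any (λ k → hit? k v) one-hit) ⟩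
  sum (λ v → sum (λ k → 𝟙 (hit? k v)))  ≡⟨ ∑-comm (λ v k → 𝟙 (hit? k v)) ⟩
  sum (λ k → sum (λ v → 𝟙 (hit? k v)))  ≡⟨ sum-cong-≗ row ⟩
  sum (λ k → 𝟙 (P? k))                  ∎
  where
  open ≡-Reasoning
  hit? : (k : Fin m) (v : Fin n) → Dec (P k × s k ≡ v)
  hit? k v = P? k ×-dec (s k ≟ v)
  one-hit : ∀ {v a b} → P a × s a ≡ v → P b × s b ≡ v → a ≡ b
  one-hit (_ , e) (_ , e′) = s-inj (trans e (sym e′))
  row : ∀ k → sum (λ v → 𝟙 (hit? k v)) ≡ 𝟙 (P? k)
  row k = trans (∑-supported (s k) _ (λ v v≢sk → 𝟙-no (hit? k v) (λ (_ , e) → v≢sk (sym e))))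
                (𝟙-cong (hit? k (s k)) (P? k) proj₁ (_, refl))

-- wallOf room R i is definitionally wall (room R) i.
wall : (Fin d → Fin n) → Fin d → Subset n
wall s i = image (λ k → ¬? (k ≟ i)) s

∣wall∣ : {s : Fin d → Fin n} → Injective _≡_ _≡_ s → (i : Fin d) → ∣ wall s i ∣ ≡ d ∸ 1
∣wall∣ s-inj i = trans (∣image∣ (λ k → ¬? (k ≟ i)) s-inj) (∑-𝟙-≢ i)

∈-wall⁺ : (s : Fin d → Fin n) {i k : Fin d} → k ≢ i → s k ∈ wall s i
∈-wall⁺ s {i} {k} k≢i =
  ∈-tabulate⁺ (λ v → any? λ k → ¬? (k ≟ i) ×-dec (s k ≟ v)) (k , k≢i , refl)

∈-wall⁻ : (s : Fin d → Fin n) {i : Fin d} {v : Fin n} →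
          v ∈ wall s i → ∃ λ k → k ≢ i × s k ≡ v
∈-wall⁻ s {i} = ∈-tabulate⁻ (λ v → any? λ k → ¬? (k ≟ i) ×-dec (s k ≟ v))

∉-wall⇒≢ : (s : Fin d → Fin n) {i k : Fin d} {u : Fin n} →
           u ∉ wall s i → k ≢ i → s k ≢ u
∉-wall⇒≢ s u∉ k≢i refl = u∉ (∈-wall⁺ s k≢i)

-- Otherwise s' would factor injectively through the d - 1 positions k ≢ i.
∃-∉-wall : (s : Fin d → Fin n) {s' : Fin d → Fin n} → Injective _≡_ _≡_ s' →
           (i : Fin d) → ∃ λ j → s' j ∉ wall s i
∃-∉-wall {d = d} s {s'} s'-inj i with any? (λ j → ¬? (s' j ∈? wall s i))
... | yes outside = outside
... | no none =
  contradiction (proj₂ (injective⇒surjective κ-inj i)) (proj₁ (proj₂ (covered _)))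
  where
  covered : ∀ j → ∃ λ k → k ≢ i × s k ≡ s' j
  covered j with s' j ∈? wall s i
  ... | yes s'j∈ = ∈-wall⁻ s s'j∈
  ... | no  s'j∉ = contradiction (j , s'j∉) none
  κ : Fin d → Fin d
  κ = proj₁ ∘ covered
  κ-inj : Injective _≡_ _≡_ κ
  κ-inj {a} {b} e = s'-inj (trans (sym (proj₂ (proj₂ (covered a))))
                             (trans (cong s e) (proj₂ (proj₂ (covered b)))))

permute-injective : (π : Permutation′ m) → Injective _≡_ _≡_ (π ⟨$⟩ʳ_)
permute-injective π e = trans (sym (inverseˡ π)) (trans (cong (π ⟨$⟩ˡ_) e) (inverseˡ π))

MonotoneExcept : Fin m → Permutation′ m → Set
MonotoneExcept i π = ∀ a b → a ≢ i → b ≢ i → a < b → π ⟨$⟩ʳ a < π ⟨$⟩ʳ b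

inversion? : (π : Permutation′ m) (a b : Fin m) → Dec (a < b × π ⟨$⟩ʳ b < π ⟨$⟩ʳ a)
inversion? π a b = (a <? b) ×-dec (π ⟨$⟩ʳ b <? π ⟨$⟩ʳ a)

inversions-monotoneExcept : {i : Fin m} (π : Permutation′ m) → MonotoneExcept i π →
  inversions π ≡ sum (λ a → 𝟙 (inversion? π a i)) + sum (λ b → 𝟙 (inversion? π i b))
inversions-monotoneExcept {m} {i} π monotone = begin
  inversions π
    ≡⟨ countL-allFin² (λ (a , b) → inversion? π a b) ⟩
  sum (λ a → sum (λ b → x a b))
    ≡⟨ sum-cong-≗ (λ a → sum-cong-≗ (through-i a)) ⟩
  sum (λ a → sum (λ b → 𝟙 (b ≟ i) * x a b + 𝟙 (a ≟ i) * x a b))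
    ≡⟨ sum-cong-≗ (λ a → ∑-distrib-+ (column a) (row a)) ⟩
  sum (λ a → sum (column a) + sum (row a))
    ≡⟨ ∑-distrib-+ (λ a → sum (column a)) (λ a → sum (row a)) ⟩
  sum (λ a → sum (column a)) + sum (λ a → sum (row a))
    ≡⟨ cong₂ _+_ (sum-cong-≗ (λ a → ∑-δ i (x a)))
                 (trans (∑-comm row) (sum-cong-≗ (λ b → ∑-δ i (λ a → x a b)))) ⟩
  sum (λ a → x a i) + sum (λ b → x i b) ∎
  where
  open ≡-Reasoning
  x : Fin m → Fin m → ℕ
  x a b = 𝟙 (inversion? π a b)
  column row : Fin m → Fin m → ℕ
  column a b = 𝟙 (b ≟ i) * x a b
  row a b = 𝟙 (a ≟ i) * x a b
  through-i : ∀ a b → x a b ≡ 𝟙 (b ≟ i) * x a b + 𝟙 (a ≟ i) * x a b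
  through-i a b with a ≟ i | b ≟ i
  ... | yes refl | yes refl
    rewrite 𝟙-no (inversion? π a a) (λ (a<a , _) → Fin.<-irrefl refl a<a) = refl
  ... | yes _    | no _     = sym (ℕ.+-identityʳ _)
  ... | no _     | yes _    = sym (trans (ℕ.+-identityʳ _) (ℕ.+-identityʳ _))
  ... | no a≢i   | no b≢i   = 𝟙-no (inversion? π a b)
    (λ (a<b , πb<πa) → Fin.<-asym πb<πa (monotone a b a≢i b≢i a<b))

-- π(i) counts the k with π(k) < π(i); adding the inversions through i, every k < i is
-- counted exactly once and every k > i an even number of times.
inversions+position : {i : Fin m} (π : Permutation′ m) → MonotoneExcept i π →
  let Bᵢ = sum (λ b → 𝟙 (inversion? π i b))
  in inversions π + toℕ (π ⟨$⟩ʳ i) ≡ toℕ i + (Bᵢ + Bᵢ)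
inversions+position {m} {i} π monotone = begin
  inversions π + toℕ (π ⟨$⟩ʳ i)
    ≡⟨ cong₂ _+_ (inversions-monotoneExcept π monotone) position ⟩
  sum (λ k → x k i) + Bᵢ + sum below
    ≡⟨ cong (_+ sum below) (sym (∑-distrib-+ (λ k → x k i) (λ k → x i k))) ⟩
  sum (λ k → x k i + x i k) + sum below
    ≡⟨ sym (∑-distrib-+ (λ k → x k i + x i k) below) ⟩
  sum (λ k → x k i + x i k + below k)
    ≡⟨ sum-cong-≗ per-position ⟩
  sum (λ k → before k + (x i k + x i k))
    ≡⟨ ∑-distrib-+ before (λ k → x i k + x i k) ⟩
  sum before + sum (λ k → x i k + x i k)
    ≡⟨ cong₂ _+_ (∑-𝟙-< i) (∑-distrib-+ (λ k → x i k) (λ k → x i k)) ⟩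
  toℕ i + (Bᵢ + Bᵢ) ∎
  where
  open ≡-Reasoning
  x : Fin m → Fin m → ℕ
  x a b = 𝟙 (inversion? π a b)
  Bᵢ : ℕ
  Bᵢ = sum (λ b → x i b)
  before below : Fin m → ℕ
  before k = 𝟙 (k <? i)
  below k = 𝟙 (π ⟨$⟩ʳ k <? π ⟨$⟩ʳ i)
  position : toℕ (π ⟨$⟩ʳ i) ≡ sum below
  position = trans (sym (∑-𝟙-< (π ⟨$⟩ʳ i))) (∑-permute (λ k → 𝟙 (k <? π ⟨$⟩ʳ i)) π)
  per-position : ∀ k → x k i + x i k + below k ≡ before k + (x i k + x i k)
  per-position k with Fin.<-cmp k i
  ... | tri< k<i k≢i i≮k
    rewrite 𝟙-no (inversion? π i k) (i≮k ∘ proj₁) | 𝟙-yes (k <? i) k<i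
          | 𝟙-cong (inversion? π k i) (π ⟨$⟩ʳ i <? π ⟨$⟩ʳ k) proj₂ (k<i ,_)
          | ℕ.+-identityʳ (𝟙 (π ⟨$⟩ʳ i <? π ⟨$⟩ʳ k))
    = 𝟙-<-trichotomy (k≢i ∘ sym ∘ permute-injective π)
  ... | tri≈ _ refl _
    rewrite 𝟙-no (inversion? π k k) (λ (k<k , _) → Fin.<-irrefl refl k<k)
          | 𝟙-no (k <? k) (Fin.<-irrefl refl)
          | 𝟙-no (π ⟨$⟩ʳ k <? π ⟨$⟩ʳ k) (Fin.<-irrefl refl) = refl
  ... | tri> k≮i _ i<k
    rewrite 𝟙-no (inversion? π k i) (k≮i ∘ proj₁) | 𝟙-no (k <? i) k≮i
          | 𝟙-cong (inversion? π i k) (π ⟨$⟩ʳ k <? π ⟨$⟩ʳ i) proj₂ (i<k ,_) = refl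

signPow-+ : (a b : ℕ) → signPow (a + b) ≡ signPow a *ˢ signPow b
signPow-+ zero    b = refl
signPow-+ (suc a) b =
  trans (cong opposite (signPow-+ a b)) (sym (Sign.*-assoc Sign.- (signPow a) (signPow b)))

signPow-even : (b : ℕ) → signPow (b + b) ≡ Sign.+
signPow-even b = trans (signPow-+ b b) (Sign.s*s≡+ (signPow b))

parity-monotoneExcept : {i : Fin m} (π : Permutation′ m) → MonotoneExcept i π →
                        parity π *ˢ signPow (toℕ (π ⟨$⟩ʳ i)) ≡ signPow (toℕ i)
parity-monotoneExcept {i = i} π monotone = begin
  parity π *ˢ signPow (toℕ (π ⟨$⟩ʳ i))   ≡⟨ sym (signPow-+ (inversions π) _) ⟩
  signPow (inversions π + toℕ (π ⟨$⟩ʳ i)) ≡⟨ cong signPow (inversions+position π monotone) ⟩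
  signPow (toℕ i + (Bᵢ + Bᵢ))             ≡⟨ signPow-+ (toℕ i) (Bᵢ + Bᵢ) ⟩
  signPow (toℕ i) *ˢ signPow (Bᵢ + Bᵢ)    ≡⟨ cong (signPow (toℕ i) *ˢ_) (signPow-even Bᵢ) ⟩
  signPow (toℕ i) *ˢ Sign.+               ≡⟨ Sign.*-identityʳ (signPow (toℕ i)) ⟩
  signPow (toℕ i)                         ∎
  where
  open ≡-Reasoning
  Bᵢ : ℕ
  Bᵢ = sum (λ b → 𝟙 (inversion? π i b))

opposite-*-opposite : (a b : Sign) → opposite a *ˢ opposite b ≡ a *ˢ b
opposite-*-opposite Sign.+ b = Sign.opposite-involutive b
opposite-*-opposite Sign.- b = refl

-- The second hypothesis is PairingOpposite unfolded:
-- induced σ R i reduces to opposite (signPow (toℕ i)) *ˢ σ R.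
orientation-transfer : {p a b x y : Sign} → p *ˢ a ≡ b →
                       opposite a *ˢ y ≡ opposite (opposite b *ˢ x) → y ≡ opposite (x *ˢ p)
orientation-transfer {p} {a} {b} {x} {y} pa≡b induced-opposite =
  Sign.*-cancelˡ-≡ (opposite a) y _ (begin
  opposite a *ˢ y                      ≡⟨ induced-opposite ⟩
  opposite (opposite b *ˢ x)           ≡⟨ sym (Sign.*-assoc Sign.- (opposite b) x) ⟩
  opposite (opposite b) *ˢ x           ≡⟨ cong (_*ˢ x) (Sign.opposite-involutive b) ⟩
  b *ˢ x                               ≡⟨ cong (_*ˢ x) (sym pa≡b) ⟩
  p *ˢ a *ˢ x                          ≡⟨ cong (_*ˢ x) (Sign.*-comm p a) ⟩
  a *ˢ p *ˢ x                          ≡⟨ Sign.*-assoc a p x ⟩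
  a *ˢ (p *ˢ x)                        ≡⟨ cong (a *ˢ_) (Sign.*-comm p x) ⟩
  a *ˢ (x *ˢ p)                        ≡⟨ sym (opposite-*-opposite a (x *ˢ p)) ⟩
  opposite a *ˢ opposite (x *ˢ p)      ∎)
  where open ≡-Reasoning

module _ {s : Fin d → Fin n} {i : Fin d} {u : Fin n} where

  private
    untouched : ∀ {k} → k ≢ i → updateAt s i (λ _ → u) k ≡ s k
    untouched {k} = VecF.updateAt-minimal k i s

  updateAt-injective : Injective _≡_ _≡_ s → u ∉ wall s i →
                       Injective _≡_ _≡_ (updateAt s i (λ _ → u))
  updateAt-injective s-inj u∉ {a} {b} e with a ≟ i | b ≟ i
  ... | yes a≡i  | yes b≡i = trans a≡i (sym b≡i)
  ... | yes refl | no b≢i  = contradiction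
    (trans (sym (untouched b≢i)) (trans (sym e) (VecF.updateAt-updates a s))) (∉-wall⇒≢ s u∉ b≢i)
  ... | no a≢i   | yes refl = contradiction
    (trans (sym (untouched a≢i)) (trans e (VecF.updateAt-updates b s))) (∉-wall⇒≢ s u∉ a≢i)
  ... | no a≢i   | no b≢i  = s-inj (trans (sym (untouched a≢i)) (trans e (untouched b≢i)))

  module _ {s' : Fin d → Fin n} (π : Permutation′ d)
           (realigned : ∀ k → s' (π ⟨$⟩ʳ k) ≡ updateAt s i (λ _ → u) k) where

    realigned-off : ∀ {k} → k ≢ i → s' (π ⟨$⟩ʳ k) ≡ s k
    realigned-off {k} k≢i = trans (realigned k) (untouched k≢i)

    wall-realigned : wall s' (π ⟨$⟩ʳ i) ≡ wall s i
    wall-realigned = Vec.tabulate-cong λ v → does-⇔ (mk⇔ to from)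
      (any? λ k → ¬? (k ≟ π ⟨$⟩ʳ i) ×-dec (s' k ≟ v)) (any? λ k → ¬? (k ≟ i) ×-dec (s k ≟ v))
      where
      to : ∀ {v} → (∃ λ k → k ≢ π ⟨$⟩ʳ i × s' k ≡ v) → ∃ λ k → k ≢ i × s k ≡ v
      to (k , k≢πi , e) =
        π ⟨$⟩ˡ k , k′≢i , trans (sym (realigned-off k′≢i)) (trans (cong s' (inverseʳ π)) e)
        where k′≢i = λ k′≡i → k≢πi (trans (sym (inverseʳ π)) (cong (π ⟨$⟩ʳ_) k′≡i))
      from : ∀ {v} → (∃ λ k → k ≢ i × s k ≡ v) → ∃ λ k → k ≢ π ⟨$⟩ʳ i × s' k ≡ v
      from (k , k≢i , e) = π ⟨$⟩ʳ k , k≢i ∘ permute-injective π , trans (realigned-off k≢i) e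

    realigned-monotoneExcept : StrictlyIncreasing s → StrictlyIncreasing s' → MonotoneExcept i π
    realigned-monotoneExcept s↑ s'↑ a b a≢i b≢i a<b = strictlyIncreasing-reflects-< s'↑
      (subst₂ _<_ (sym (realigned-off a≢i)) (sym (realigned-off b≢i)) (s↑ a b a<b))

module _ {d n N : ℕ} (room : Fin N → Fin d → Fin n)
         (increasing : ∀ R → StrictlyIncreasing (room R))
         (mate : Subset n → Fin N → Fin N) (pairing : IsPairing room mate) where

  private
    room-injective : ∀ R → Injective _≡_ _≡_ (room R)
    room-injective R = strictlyIncreasing⇒injective (increasing R)

    ∈-roomSet⁻ : ∀ R {v} → v ∈ roomSet room R → ∃ λ k → room R k ≡ v
    ∈-roomSet⁻ R = ∈-tabulate⁻ (λ v → any? λ k → room R k ≟ v)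

    wall⊆roomSet : ∀ R i → wallOf room R i ⊆ roomSet room R
    wall⊆roomSet R i v∈W with k , _ , e ← ∈-wall⁻ (room R) v∈W =
      ∈-tabulate⁺ (λ v → any? λ k → room R k ≟ v) (k , e)

    paired : ∀ R i → let W = wallOf room R i in
             W ⊆ roomSet room (mate W R) × mate W R ≢ R × mate W (mate W R) ≡ R
    paired R i = pairing _ (∣wall∣ (room-injective R) i) R (wall⊆roomSet R i)

  pivotMap-isPivotingSystem : IsPivotingSystem d room (pivotMap room mate)
  pivotMap-isPivotingSystem R i
    with W⊆R' , _ , mate-back ← paired R i
       | j , u∉W ← ∃-∉-wall (room R) (room-injective (pivotMap room mate R i)) i
    = π , (u , realigned) , trans (cong (λ W → mate W R') (wall-realigned π realigned)) mate-back
    where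
    R' : Fin N
    R' = pivotMap room mate R i
    u : Fin n
    u = room R' j
    occurs : ∀ k → ∃ λ k' → room R' k' ≡ updateAt (room R) i (λ _ → u) k
    occurs k with k ≟ i
    ... | yes refl = j , sym (VecF.updateAt-updates k (room R))
    ... | no k≢i   with k' , e ← ∈-roomSet⁻ R' (W⊆R' (∈-wall⁺ (room R) k≢i)) =
      k' , trans e (sym (VecF.updateAt-minimal k i (room R) k≢i))
    π-realigned = realign (updateAt-injective (room-injective R) u∉W) occurs
    π = proj₁ π-realigned
    realigned = proj₂ π-realigned

  pivotMap-isOrientedBy : (σ : Fin N → Sign) → PairingOpposite room mate σ →
                          IsOrientedBy d room (pivotMap room mate) σ
  pivotMap-isOrientedBy σ opposite-pair R i π ((_ , realigned) , _) = orientation-transfer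
    (parity-monotoneExcept π monotone)
    (opposite-pair _ (∣wall∣ (room-injective R) i) R i (π ⟨$⟩ʳ i) refl (wall-realigned π realigned))
    where
    monotone : MonotoneExcept i π
    monotone = realigned-monotoneExcept π realigned (increasing R) (increasing (pivotMap room mate R i))

proposition3 : (d n N : ℕ) → 2 ≤ d →
    (room : Fin N → Fin d → Fin n) → (∀ R → StrictlyIncreasing (room R)) →
    IsOik room →
    (mate : Subset n → Fin N → Fin N) → IsPairing room mate →
    IsPivotingSystem d room (pivotMap room mate)
    × ((σ : Fin N → Sign) → IsCoherent room σ → PairingOpposite room mate σ →
       IsOrientedBy d room (pivotMap room mate) σ)
proposition3 d n N _ room increasing _ mate pairing =
  pivotMap-isPivotingSystem room increasing mate pairing ,
  λ σ _ → pivotMap-isOrientedBy room increasing mate pairing σ
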